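{- Let $\Psi$ be a $u$-universal contig with $n$ semiblocks and let $W\in\mathcal{B}(\Psi)$. Then $\#[F_l(N_l(W)),F_l(W))=O(n+u-d_{\mathcal{G}(\Psi)}(W))$.
   Context: An ordered semiblock family is a sequence $\mathcal{B}=B_1,\dots,B_k$ of pairwise disjoint nonempty sets (semiblocks); indices modulo $k$. For $X=B_i$, $Y=B_j$, $[X,Y]$ is the sequence $B_i,\dots,B_j$ (indices modulo $k$) and $[X,Y)$, $(X,Y]$ delete its last, resp. first, element; $\#S$ is the number of elements of a range $S$. A round representation is $\Psi=(\mathcal{B}(\Psi),F_r)$ with $F_r:\mathcal{B}\to\mathcal{B}$ and $F_r(B_i)\in[B_i,F_r(B_{i+1})]$ for all $i$; $B\to W$ means $W\in(B,F_r(B)]$. Representations are normal: never both $B\to W$ and $W\to B$. $F_l(B_i)$ is the unique $B_j$ with ($B_j\to B_i$ or $B_j=B_i$) and ($B_{j-1}=B_i$ or $B_{j-1}\not\to B_i$); $N_l(B_i)=B_{i-1}$ if $B_{i-1}\to B_i$, else $B_i$. The round graph $\mathcal{G}(\Psi)$ has vertex set $\mathcal{B}$, $B,W$ adjacent iff $B\to W$ or $W\to B$; $d_{\mathcal{G}(\Psi)}(W)$ is the degree of $W$ in it. $\Psi$ is a contig if $\mathcal{G}(\Psi)$ is connected, and $u$-universal if $\mathcal{G}(\Psi)$ has at most $u$ universal vertices. -}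

module Defs where

open import Data.Nat using (ℕ; zero; suc; _+_; _*_; _∸_; _≤_; _<_; _≤?_; _<?_)
open import Data.Nat.DivMod using (_%_; m%n<n)
open import Data.Fin using (Fin; toℕ; fromℕ<)
open import Data.Fin.Properties using (_≟_)
open import Data.List using (List; length; filter; allFin)
open import Data.List.Relation.Unary.All using (All)
open import Data.List.Relation.Unary.Unique.Propositional using (Unique)
open import Data.Product using (_×_; _,_)
open import Data.Sum using (_⊎_)
open import Relation.Nullary using (¬_; Dec; yes; no)
open import Relation.Nullary.Decidable using (_×-dec_; _⊎-dec_)
open import Relation.Binary.PropositionalEquality using (_≡_; _≢_)
open import Relation.Binary.Construct.Closure.ReflexiveTransitive using (Star)

-- An ordered semiblock family with k = suc m semiblocks B_0,...,B_m,
-- semiblocks are represented by their indices in Fin (suc m).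
-- (The element sets of the semiblocks play no role in the statement.)

-- number of steps from B_i forward (cyclically) to B_j, i.e. #[B_i,B_j)
dist : ∀ {m} → Fin (suc m) → Fin (suc m) → ℕ
dist {m} i j = (suc m + toℕ j ∸ toℕ i) % suc m

next : ∀ {m} → Fin (suc m) → Fin (suc m)
next {m} i = fromℕ< (m%n<n (suc (toℕ i)) (suc m))

prev : ∀ {m} → Fin (suc m) → Fin (suc m)
prev {m} i = fromℕ< (m%n<n (toℕ i + m) (suc m))

InCC : ∀ {m} → Fin (suc m) → Fin (suc m) → Fin (suc m) → Set
InCC i j w = dist i w ≤ dist i j

InOC : ∀ {m} → Fin (suc m) → Fin (suc m) → Fin (suc m) → Set
InOC i j w = (0 < dist i w) × (dist i w ≤ dist i j)

record RoundRep (m : ℕ) : Set where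
  field
    Fr     : Fin (suc m) → Fin (suc m)
    Fr-ok  : ∀ i → InCC i (Fr (next i)) (Fr i)
  _⟶_ : Fin (suc m) → Fin (suc m) → Set
  b ⟶ w = InOC b (Fr b) w
  field
    normal : ∀ b w → ¬ ((b ⟶ w) × (w ⟶ b))



module _ {m : ℕ} (Ψ : RoundRep m) where
  open RoundRep Ψ using (Fr; _⟶_)

  ⟶? : ∀ b w → Dec (b ⟶ w)
  ⟶? b w = (0 <? dist b w) ×-dec (dist b w ≤? dist b (Fr b))

  -- F_l(B_i) = B_j  (defined relationally, as "the unique B_j such that ...")
  IsFl : Fin (suc m) → Fin (suc m) → Set
  IsFl i j = ((j ⟶ i) ⊎ (j ≡ i)) × ((prev j ≡ i) ⊎ ¬ (prev j ⟶ i))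

  Nl : Fin (suc m) → Fin (suc m)
  Nl i with ⟶? (prev i) i
  ... | yes _ = prev i
  ... | no  _ = i

  Adj : Fin (suc m) → Fin (suc m) → Set
  Adj b w = (b ⟶ w) ⊎ (w ⟶ b)

  Adj? : ∀ b w → Dec (Adj b w)
  Adj? b w = ⟶? b w ⊎-dec ⟶? w b

  degree : Fin (suc m) → ℕ
  degree w = length (filter (λ v → Adj? w v) (allFin (suc m)))

  Contig : Set
  Contig = ∀ x y → Star Adj x y

  Universal : Fin (suc m) → Set
  Universal b = ∀ w → w ≢ b → Adj b w

  UUniversal : ℕ → Set
  UUniversal u = ∀ (xs : List (Fin (suc m))) → Unique xs → All Universal xs → length xs ≤ u

#CO : ∀ {m} → Fin (suc m) → Fin (suc m) → ℕ
#CO i j = dist i j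

module Submission where

open import Defs
open import Data.Nat using (ℕ; zero; suc; _+_; _*_; _∸_; _≤_; _<_; _<?_; _≤?_; _≟_; z≤n; s≤s; z<s; s≤s⁻¹; NonZero)
open import Data.Nat.Properties
open import Data.Nat.DivMod
open import Data.Fin as Fin using (Fin; toℕ; fromℕ<)
open import Data.Fin.Properties using (toℕ<n; toℕ-fromℕ<; toℕ-injective)
open import Data.Product using (Σ; ∃; _×_; _,_; proj₁; proj₂)
open import Data.Sum as Sum using (_⊎_; inj₁; inj₂; [_,_]′)
open import Data.Unit using (tt)
open import Data.Empty using (⊥; ⊥-elim)
open import Data.List using (List; []; _∷_; length; filter; allFin)
open import Data.List.Properties using (filter-all; filter-some; length-tabulate)
open import Data.List.Membership.Propositional using (_∈_; lose)
open import Data.List.Membership.Propositional.Properties using (∈-allFin)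
import Data.List.Relation.Unary.All as All
open import Data.List.Relation.Unary.All.Properties using (all-filter)
import Data.List.Relation.Unary.Unique.Propositional.Properties as Unique
open import Function using (_∘_; id)
open import Relation.Binary.Definitions using (tri<; tri≈; tri>)
open import Relation.Binary.PropositionalEquality
open import Relation.Nullary using (¬_; yes; no; contradiction)
open import Relation.Nullary.Decidable using (_×-dec_)
open import Relation.Unary using (Pred; Decidable; U)
open import Relation.Unary.Properties using (_∩?_; ∁?)

-- Write pos x = #[x, W) and P = B_{i-1} for W = B_i.  The axiom F_r(B_i) ∈ [B_i, F_r(B_{i+1})]
-- makes every in-neighbourhood an interval ending at its target, so F_l(t) is the farthest
-- in-neighbour of t.  If P ↛ W then F_l(N_l(W)) = F_l(W) = W.  Otherwise b = F_l(W) and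
-- a = F_l(P) satisfy pos b ≤ pos a, and #[a, b) = pos a - pos b.  A semiblock x of [a, b) cannot
-- point to W (it lies beyond b), and if W → x then x is universal: x → P covers (x, W) and
-- W → x is reached from all of (W, x).  Hence [a, b) consists of at most u universal semiblocks
-- and of non-neighbours of W, and the bound holds with c = 1.

%-absorbˡ : ∀ a b n .{{_ : NonZero n}} → (a % n + b) % n ≡ (a + b) % n
%-absorbˡ a b n = begin
  (a % n + b) % n         ≡⟨ %-distribˡ-+ (a % n) b n ⟩
  (a % n % n + b % n) % n ≡⟨ cong (λ v → (v + b % n) % n) (m%n%n≡m%n a n) ⟩
  (a % n + b % n) % n     ≡⟨ %-distribˡ-+ a b n ⟨
  (a + b) % n             ∎
  where open ≡-Reasoning

%-absorbʳ : ∀ a b n .{{_ : NonZero n}} → (a + b % n) % n ≡ (a + b) % n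
%-absorbʳ a b n = begin
  (a + b % n) % n ≡⟨ cong (_% n) (+-comm a (b % n)) ⟩
  (b % n + a) % n ≡⟨ %-absorbˡ b a n ⟩
  (b + a) % n     ≡⟨ cong (_% n) (+-comm b a) ⟩
  (a + b) % n     ∎
  where open ≡-Reasoning

%-cancel-+ˡ : ∀ x a b n .{{_ : NonZero n}} → x ≤ n → (x + a) % n ≡ (x + b) % n → a % n ≡ b % n
%-cancel-+ˡ x a b n x≤n eq = trans (unshift a) (trans (cong (λ v → (n ∸ x + v) % n) eq) (sym (unshift b)))
  where
  open ≡-Reasoning
  unshift : ∀ c → c % n ≡ (n ∸ x + (x + c) % n) % n
  unshift c = begin
    c % n                   ≡⟨ [m+n]%n≡m%n c n ⟨
    (c + n) % n             ≡⟨ cong (_% n) (+-comm c n) ⟩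
    (n + c) % n             ≡⟨ cong (λ v → (v + c) % n) (m∸n+n≡m x≤n) ⟨
    (n ∸ x + x + c) % n     ≡⟨ cong (_% n) (+-assoc (n ∸ x) x c) ⟩
    (n ∸ x + (x + c)) % n   ≡⟨ %-absorbʳ (n ∸ x) (x + c) n ⟨
    (n ∸ x + (x + c) % n) % n ∎

%-wrap : ∀ s n .{{_ : NonZero n}} → s < n + n → s % n ≡ s ⊎ s ≡ n + s % n
%-wrap s n s<2n with s <? n
... | yes s<n = inj₁ (m<n⇒m%n≡m s<n)
... | no s≮n = inj₂ (begin
  s               ≡⟨ m+[n∸m]≡n n≤s ⟨
  n + (s ∸ n)     ≡⟨ cong (n +_) (m<n⇒m%n≡m (m<n+o⇒m∸n<o s n s<2n)) ⟨
  n + (s ∸ n) % n ≡⟨ cong (n +_) (m≤n⇒[n∸m]%m≡n%m n≤s) ⟩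
  n + s % n       ∎)
  where
  open ≡-Reasoning
  n≤s = ≮⇒≥ s≮n

module _ {a p q r} {A : Set a} {P : Pred A p} {Q : Pred A q} {R : Pred A r}
         (P? : Decidable P) (Q? : Decidable Q) (R? : Decidable R) where

  length-filter-disjoint-⊆ : (∀ {x} → Q x → ¬ R x) → (∀ {x} → Q x ⊎ R x → P x) → ∀ xs →
                             length (filter Q? xs) + length (filter R? xs) ≤ length (filter P? xs)
  length-filter-disjoint-⊆ disj sub [] = z≤n
  length-filter-disjoint-⊆ disj sub (x ∷ xs) with ih ← length-filter-disjoint-⊆ disj sub xs | Q? x | R? x | P? x
  ... | yes qx | yes rx | _     = contradiction rx (disj qx)
  ... | yes qx | no _   | yes _ = s≤s ih
  ... | yes qx | no _   | no ¬p = contradiction (sub (inj₁ qx)) ¬p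
  ... | no _   | yes rx | yes _ =
    subst (_≤ suc (length (filter P? xs))) (sym (+-suc (length (filter Q? xs)) _)) (s≤s ih)
  ... | no _   | yes rx | no ¬p = contradiction (sub (inj₂ rx)) ¬p
  ... | no _   | no _   | yes _ = m≤n⇒m≤1+n ih
  ... | no _   | no _   | no _  = ih

module _ {a q r} {A : Set a} {Q : Pred A q} {R : Pred A r} (Q? : Decidable Q) (R? : Decidable R) where

  length-filter-disjoint : (∀ {x} → Q x → ¬ R x) → ∀ xs →
                           length (filter Q? xs) + length (filter R? xs) ≤ length xs
  length-filter-disjoint disj xs =
    subst (length (filter Q? xs) + length (filter R? xs) ≤_) (cong length (filter-all U? (All.universal _ xs)))
          (length-filter-disjoint-⊆ U? Q? R? disj _ xs)
    where
    U? : Decidable {A = A} U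
    U? _ = yes tt

  length-filter-split : ∀ xs → length (filter Q? xs) ≡
                        length (filter (Q? ∩? R?) xs) + length (filter (Q? ∩? ∁? R?) xs)
  length-filter-split [] = refl
  length-filter-split (x ∷ xs) with ih ← length-filter-split xs | Q? x | R? x
  ... | yes _ | yes _ = cong suc ih
  ... | yes _ | no _  = trans (cong suc ih) (sym (+-suc (length (filter (Q? ∩? R?) xs)) _))
  ... | no _  | _     = ih

length-filter-range : ∀ {a} {A : Set a} (f : A → ℕ) (xs : List A) lo d →
                      (∀ k → lo < k → k ≤ lo + d → ∃ λ x → x ∈ xs × f x ≡ k) →
                      d ≤ length (filter (λ x → (lo <? f x) ×-dec (f x ≤? lo + d)) xs)
length-filter-range f xs lo zero hit = z≤n
length-filter-range f xs lo (suc d) hit =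
  ≤-trans (≤-reflexive (+-comm 1 d)) (≤-trans (+-mono-≤ below top)
          (length-filter-disjoint-⊆ _ _ (λ x → f x ≟ lo + suc d) disj sub xs))
  where
  below : d ≤ length (filter (λ x → (lo <? f x) ×-dec (f x ≤? lo + d)) xs)
  below = length-filter-range f xs lo d
            (λ k lo<k k≤ → hit k lo<k (≤-trans k≤ (+-monoʳ-≤ lo (n≤1+n d))))
  top : 1 ≤ length (filter (λ x → f x ≟ lo + suc d) xs)
  top with x , x∈xs , fx≡ ← hit (lo + suc d) (m<m+n lo z<s) ≤-refl =
    filter-some (λ x → f x ≟ lo + suc d) (lose x∈xs fx≡)
  disj : ∀ {x} → lo < f x × f x ≤ lo + d → f x ≢ lo + suc d
  disj (_ , fx≤) fx≡ = <⇒≱ (+-monoʳ-< lo (n<1+n d)) (subst (_≤ lo + d) fx≡ fx≤)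
  sub : ∀ {x} → (lo < f x × f x ≤ lo + d) ⊎ f x ≡ lo + suc d → lo < f x × f x ≤ lo + suc d
  sub (inj₁ (lo< , fx≤)) = lo< , ≤-trans fx≤ (+-monoʳ-≤ lo (n≤1+n d))
  sub (inj₂ fx≡) = subst (lo <_) (sym fx≡) (m<m+n lo z<s) , ≤-reflexive fx≡

module _ {m : ℕ} where

  dist< : ∀ (x y : Fin (suc m)) → dist x y < suc m
  dist< x y = m%n<n (suc m + toℕ y ∸ toℕ x) (suc m)

  dist-correct : ∀ (x y : Fin (suc m)) → (toℕ x + dist x y) % suc m ≡ toℕ y
  dist-correct x y = begin
    (toℕ x + dist x y) % suc m                  ≡⟨ %-absorbʳ (toℕ x) (suc m + toℕ y ∸ toℕ x) (suc m) ⟩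
    (toℕ x + (suc m + toℕ y ∸ toℕ x)) % suc m   ≡⟨ cong (_% suc m) (m+[n∸m]≡n x≤) ⟩
    (suc m + toℕ y) % suc m                     ≡⟨ cong (_% suc m) (+-comm (suc m) (toℕ y)) ⟩
    (toℕ y + suc m) % suc m                     ≡⟨ [m+n]%n≡m%n (toℕ y) (suc m) ⟩
    toℕ y % suc m                               ≡⟨ m<n⇒m%n≡m (toℕ<n y) ⟩
    toℕ y                                       ∎
    where
    open ≡-Reasoning
    x≤ : toℕ x ≤ suc m + toℕ y
    x≤ = ≤-trans (<⇒≤ (toℕ<n x)) (m≤m+n (suc m) (toℕ y))

  dist-unique : ∀ {x y : Fin (suc m)} {d} → d < suc m → (toℕ x + d) % suc m ≡ toℕ y → dist x y ≡ d
  dist-unique {x} {y} {d} d<n eq = begin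
    dist x y          ≡⟨ m<n⇒m%n≡m (dist< x y) ⟨
    dist x y % suc m  ≡⟨ %-cancel-+ˡ (toℕ x) (dist x y) d (suc m) (<⇒≤ (toℕ<n x))
                                      (trans (dist-correct x y) (sym eq)) ⟩
    d % suc m         ≡⟨ m<n⇒m%n≡m d<n ⟩
    d                 ∎
    where open ≡-Reasoning

  dist-triangle : ∀ (x y z : Fin (suc m)) →
                  dist x y + dist y z ≡ dist x z ⊎ dist x y + dist y z ≡ suc m + dist x z
  dist-triangle x y z =
    Sum.map (λ eq → trans (sym eq) dist-xz) (λ eq → trans eq (cong (suc m +_) dist-xz))
            (%-wrap (dist x y + dist y z) (suc m) (+-mono-< (dist< x y) (dist< y z)))
    where
    open ≡-Reasoning
    dist-xz : (dist x y + dist y z) % suc m ≡ dist x z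
    dist-xz = sym (dist-unique {x} {z} (m%n<n (dist x y + dist y z) (suc m)) (begin
      (toℕ x + (dist x y + dist y z) % suc m) % suc m  ≡⟨ %-absorbʳ (toℕ x) _ (suc m) ⟩
      (toℕ x + (dist x y + dist y z)) % suc m          ≡⟨ cong (_% suc m) (+-assoc (toℕ x) _ _) ⟨
      (toℕ x + dist x y + dist y z) % suc m            ≡⟨ %-absorbˡ (toℕ x + dist x y) (dist y z) (suc m) ⟨
      ((toℕ x + dist x y) % suc m + dist y z) % suc m  ≡⟨ cong (λ v → (v + dist y z) % suc m) (dist-correct x y) ⟩
      (toℕ y + dist y z) % suc m                       ≡⟨ dist-correct y z ⟩
      toℕ z                                            ∎))

  dist-refl : ∀ (x : Fin (suc m)) → dist x x ≡ 0
  dist-refl x = trans (cong (_% suc m) (m+n∸n≡m (suc m) (toℕ x))) (n%n≡0 (suc m))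

  dist≡0⇒≡ : ∀ {x y : Fin (suc m)} → dist x y ≡ 0 → x ≡ y
  dist≡0⇒≡ {x} {y} eq = toℕ-injective (begin
    toℕ x                       ≡⟨ m<n⇒m%n≡m (toℕ<n x) ⟨
    toℕ x % suc m               ≡⟨ cong (_% suc m) (+-identityʳ (toℕ x)) ⟨
    (toℕ x + 0) % suc m         ≡⟨ cong (λ d → (toℕ x + d) % suc m) eq ⟨
    (toℕ x + dist x y) % suc m  ≡⟨ dist-correct x y ⟩
    toℕ y                       ∎)
    where open ≡-Reasoning

  dist-pos : ∀ {x y : Fin (suc m)} → x ≢ y → 0 < dist x y
  dist-pos x≢y = n≢0⇒n>0 (x≢y ∘ dist≡0⇒≡)

  ≢⇒1≤m : ∀ {x y : Fin (suc m)} → x ≢ y → 1 ≤ m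
  ≢⇒1≤m {x} {y} x≢y = ≤-trans (dist-pos x≢y) (s≤s⁻¹ (dist< x y))

  dist-+ : ∀ {x y z : Fin (suc m)} → dist x y + dist y z < suc m + dist x z →
           dist x y + dist y z ≡ dist x z
  dist-+ {x} {y} {z} lt with dist-triangle x y z
  ... | inj₁ eq = eq
  ... | inj₂ eq = contradiction eq (<⇒≢ lt)

  dist-+ˡ : ∀ {x y z : Fin (suc m)} → dist x y ≤ dist x z → dist x y + dist y z ≡ dist x z
  dist-+ˡ {x} {y} {z} le = dist-+ {x} {y} {z} (begin-strict
    dist x y + dist y z  <⟨ +-monoʳ-< (dist x y) (dist< y z) ⟩
    dist x y + suc m     ≤⟨ +-monoˡ-≤ (suc m) le ⟩
    dist x z + suc m     ≡⟨ +-comm (dist x z) (suc m) ⟩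
    suc m + dist x z     ∎)
    where open ≤-Reasoning

  dist-+ʳ : ∀ {x y z : Fin (suc m)} → dist y z ≤ dist x z → dist x y + dist y z ≡ dist x z
  dist-+ʳ {x} {y} {z} le = dist-+ {x} {y} {z} (+-mono-<-≤ (dist< x y) le)

  dist-injectiveˡ : ∀ {y z t : Fin (suc m)} → dist y t ≡ dist z t → y ≡ z
  dist-injectiveˡ {y} {z} {t} eq =
    dist≡0⇒≡ (+-cancelʳ-≡ (dist z t) (dist y z) 0 (trans (dist-+ʳ {y} {z} {t} (≤-reflexive (sym eq))) eq))

  dist-cycle : ∀ {x t : Fin (suc m)} → x ≢ t → dist t x + dist x t ≡ suc m
  dist-cycle {x} {t} x≢t with dist-triangle t x t
  ... | inj₁ eq = contradiction (dist≡0⇒≡ (m+n≡0⇒n≡0 (dist t x) (trans eq (dist-refl t)))) x≢t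
  ... | inj₂ eq = trans eq (trans (cong (suc m +_) (dist-refl t)) (+-identityʳ (suc m)))

  dist-step : ∀ {y y′ t : Fin (suc m)} → dist y y′ ≡ 1 → y ≢ t → dist y t ≡ suc (dist y′ t)
  dist-step {y} {y′} {t} step y≢t =
    sym (trans (cong (_+ dist y′ t) (sym step))
               (dist-+ˡ {y} {y′} {t} (≤-trans (≤-reflexive step) (dist-pos y≢t))))

  dist-to-next : 1 ≤ m → ∀ (x : Fin (suc m)) → dist x (next x) ≡ 1
  dist-to-next 1≤m x =
    dist-unique {x} {next x} (s≤s 1≤m) (trans (cong (_% suc m) (+-comm (toℕ x) 1)) (sym (toℕ-fromℕ< _)))

  dist-to-prev : ∀ (x : Fin (suc m)) → dist x (prev x) ≡ m
  dist-to-prev x = dist-unique {x} {prev x} ≤-refl (sym (toℕ-fromℕ< _))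

  dist-from-prev : 1 ≤ m → ∀ (x : Fin (suc m)) → dist (prev x) x ≡ 1
  dist-from-prev 1≤m x = +-cancelˡ-≡ m _ 1 (begin
    m + dist (prev x) x                ≡⟨ cong (_+ dist (prev x) x) (dist-to-prev x) ⟨
    dist x (prev x) + dist (prev x) x  ≡⟨ dist-cycle {prev x} {x} prev≢x ⟩
    suc m                              ≡⟨ +-comm 1 m ⟩
    m + 1                              ∎)
    where
    open ≡-Reasoning
    prev≢x : prev x ≢ x
    prev≢x eq = <⇒≢ 1≤m (trans (sym (dist-refl x)) (trans (cong (dist x) (sym eq)) (dist-to-prev x)))

  dist-next : ∀ {y t : Fin (suc m)} → y ≢ t → dist y t ≡ suc (dist (next y) t)
  dist-next {y} {t} y≢t = dist-step {y} {next y} {t} (dist-to-next (≢⇒1≤m y≢t) y) y≢t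

  dist-prev : ∀ {x t : Fin (suc m)} → dist x t < m → dist (prev x) t ≡ suc (dist x t)
  dist-prev {x} {t} lt = dist-step {prev x} {x} {t} (dist-from-prev (≤-trans (s≤s z≤n) lt) x) prev≢t
    where
    prev≢t : prev x ≢ t
    prev≢t eq = <⇒≢ lt (trans (cong (dist x) (sym eq)) (dist-to-prev x))

  dist-surjectiveˡ : ∀ (t : Fin (suc m)) k → k < suc m → ∃ λ x → dist x t ≡ k
  dist-surjectiveˡ t zero _ = t , dist-refl t
  dist-surjectiveˡ t (suc k) lt with dist-surjectiveˡ t k (<-trans (n<1+n k) lt)
  ... | x , eq = prev x , trans (dist-prev {x} {t} (subst (_< m) (sym eq) (s≤s⁻¹ lt))) (cong suc eq)

  dist-next-≤ : ∀ (y t : Fin (suc m)) → dist y t ≤ suc (dist (next y) t)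
  dist-next-≤ y t with y Fin.≟ t
  ... | yes refl = ≤-trans (≤-reflexive (dist-refl y)) z≤n
  ... | no y≢t   = ≤-reflexive (dist-next {y} {t} y≢t)

module _ {m : ℕ} (Ψ : RoundRep m) where
  open RoundRep Ψ

  ⟶⇒≢ : ∀ {x y} → x ⟶ y → x ≢ y
  ⟶⇒≢ {x} (0<d , _) refl = <⇒≢ 0<d (sym (dist-refl x))

  -- By Fr-ok the reach of a semiblock is at most one more than that of its successor.
  ⟶-next : ∀ {y t} → y ⟶ t → 0 < dist (next y) t → next y ⟶ t
  ⟶-next {y} {t} y⟶t@(_ , t≤Fr) 0<d = 0<d , s≤s⁻¹ (begin
    suc (dist (next y) t)              ≡⟨ dist-next {y = y} {t = t} (⟶⇒≢ {y} {t} y⟶t) ⟨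
    dist y t                           ≤⟨ t≤Fr ⟩
    dist y (Fr y)                      ≤⟨ Fr-ok y ⟩
    dist y (Fr (next y))               ≤⟨ dist-next-≤ y (Fr (next y)) ⟩
    suc (dist (next y) (Fr (next y)))  ∎)
    where open ≤-Reasoning

  ⟶-interval : ∀ {y z t} → y ⟶ t → 0 < dist z t → dist z t ≤ dist y t → z ⟶ t
  ⟶-interval {y} {z} {t} y⟶t 0<zt zt≤yt = walk (dist y t ∸ dist z t) y y⟶t (m∸n+n≡m zt≤yt)
    where
    walk : ∀ k y → y ⟶ t → k + dist z t ≡ dist y t → z ⟶ t
    walk zero y y⟶t eq = subst (_⟶ t) (dist-injectiveˡ {y = y} {z = z} {t = t} (sym eq)) y⟶t
    walk (suc k) y y⟶t eq =
      walk k (next y) (⟶-next {y = y} {t = t} y⟶t (≤-trans 0<zt (≤-trans (m≤n+m _ k) (≤-reflexive eq′)))) eq′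
      where
      eq′ : k + dist z t ≡ dist (next y) t
      eq′ = suc-injective (trans eq (dist-next {y = y} {t = t} (⟶⇒≢ {y} {t} y⟶t)))

  ⟶-shorten : ∀ {x s t} → x ⟶ t → 0 < dist x s → dist x s ≤ dist x t → x ⟶ s
  ⟶-shorten (_ , t≤Fr) 0<s s≤t = 0<s , ≤-trans s≤t t≤Fr

  IsFl-farthest : ∀ {t c y} → IsFl Ψ t c → y ⟶ t → dist y t ≤ dist c t
  IsFl-farthest {t} {c} {y} (_ , stop) y⟶t with dist y t ≤? dist c t
  ... | yes le = le
  ... | no ≰ = ⊥-elim (blocked stop)
    where
    c<y : dist c t < dist y t
    c<y = ≰⇒> ≰
    eq : dist (prev c) t ≡ suc (dist c t)
    eq = dist-prev {x = c} {t = t} (<-≤-trans c<y (s≤s⁻¹ (dist< y t)))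
    prev⟶ : prev c ⟶ t
    prev⟶ = ⟶-interval {y = y} {z = prev c} {t = t} y⟶t
              (subst (0 <_) (sym eq) z<s) (subst (_≤ dist y t) (sym eq) c<y)
    blocked : (prev c ≡ t) ⊎ ¬ (prev c ⟶ t) → ⊥
    blocked (inj₁ prev≡t) = ⟶⇒≢ {prev c} {t} prev⟶ prev≡t
    blocked (inj₂ prev↛) = prev↛ prev⟶

  IsFl-self : ∀ {t c} → ¬ (prev t ⟶ t) → IsFl Ψ t c → c ≡ t
  IsFl-self _ (inj₂ c≡t , _) = c≡t
  IsFl-self {t} {c} prev↛ (inj₁ c⟶t , _) =
    ⊥-elim (prev↛ (⟶-interval {y = c} {z = prev t} {t = t} c⟶t
                  (subst (0 <_) (sym step) z<s) (subst (_≤ dist c t) (sym step) (proj₁ c⟶t))))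
    where
    step : dist (prev t) t ≡ 1
    step = dist-from-prev (≢⇒1≤m (⟶⇒≢ {c} {t} c⟶t)) t

  module Fl-range (W a b : Fin (suc m)) (P⟶W : prev W ⟶ W)
                  (ha : IsFl Ψ (prev W) a) (hb : IsFl Ψ W b) where

    P : Fin (suc m)
    P = prev W

    pos : Fin (suc m) → ℕ
    pos x = dist x W

    α β : ℕ
    α = pos a
    β = pos b

    pos-P : pos P ≡ 1
    pos-P = dist-from-prev (≢⇒1≤m (⟶⇒≢ {P} {W} P⟶W)) W

    dist-P : ∀ {x} → 0 < pos x → dist x P + 1 ≡ pos x
    dist-P {x} 0<x =
      trans (cong (dist x P +_) (sym pos-P)) (dist-+ʳ {x = x} {y = P} {z = W} (subst (_≤ pos x) (sym pos-P) 0<x))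

    W↛P : ¬ (W ⟶ P)
    W↛P W⟶P = normal W P (W⟶P , P⟶W)

    0<α : 0 < α
    0<α = dist-pos a≢W
      where
      a≢W : a ≢ W
      a≢W a≡W = [ (λ a⟶P → W↛P (subst (_⟶ P) a≡W a⟶P))
                , (λ a≡P → ⟶⇒≢ {P} {W} P⟶W (trans (sym a≡P) a≡W)) ]′ (proj₁ ha)

    pos≤α : ∀ {y} → (y ⟶ P) ⊎ (y ≡ P) → pos y ≤ α
    pos≤α (inj₂ refl) = subst (_≤ α) (sym pos-P) 0<α
    pos≤α {y} (inj₁ y⟶P) = begin
      pos y         ≡⟨ dist-P {y} (dist-pos y≢W) ⟨
      dist y P + 1  ≤⟨ +-monoˡ-≤ 1 (IsFl-farthest {P} {a} {y} ha y⟶P) ⟩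
      dist a P + 1  ≡⟨ dist-P {a} 0<α ⟩
      α             ∎
      where
      open ≤-Reasoning
      y≢W : y ≢ W
      y≢W refl = W↛P y⟶P

    β≤α : β ≤ α
    β≤α with proj₁ hb
    ... | inj₂ b≡W = ≤-trans (≤-reflexive (trans (cong pos b≡W) (dist-refl W))) z≤n
    ... | inj₁ b⟶W with b Fin.≟ P
    ...   | yes b≡P = pos≤α {b} (inj₂ b≡P)
    ...   | no b≢P  = pos≤α {b} (inj₁ (⟶-shorten {b} {P} {W} b⟶W (dist-pos b≢P)
                        (≤-trans (m≤m+n (dist b P) 1) (≤-reflexive (dist-P {b} (proj₁ b⟶W))))))

    ⟶P : ∀ {x} → 1 < pos x → pos x ≤ α → x ⟶ P
    ⟶P {x} 1<x x≤α with proj₁ ha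
    ... | inj₂ a≡P = ⊥-elim (<⇒≱ 1<x (≤-trans x≤α (≤-reflexive (trans (cong pos a≡P) pos-P))))
    ... | inj₁ a⟶P = ⟶-interval {a} {x} {P} a⟶P (+-cancelʳ-≤ 1 1 (dist x P) (subst (2 ≤_) (sym x-P) 1<x))
                       (+-cancelʳ-≤ 1 (dist x P) (dist a P) (subst₂ _≤_ (sym x-P) (sym (dist-P {a} 0<α)) x≤α))
      where
      x-P : dist x P + 1 ≡ pos x
      x-P = dist-P {x} (<-trans z<s 1<x)

    universal : ∀ {x} → pos x ≤ α → W ⟶ x → Universal Ψ x
    universal {x} x≤α W⟶x y y≢x with <-cmp (pos y) (pos x)
    ... | tri≈ _ y≡x _ = ⊥-elim (y≢x (dist-injectiveˡ {y = y} {z = x} {t = W} y≡x))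
    ... | tri> _ _ x<y = inj₂ (⟶-interval {W} {y} {x} W⟶x (dist-pos y≢x) (+-cancelʳ-≤ (pos x) _ _ (begin
        dist y x + pos x  ≡⟨ dist-+ʳ {x = y} {y = x} {z = W} (<⇒≤ x<y) ⟩
        pos y             ≤⟨ <⇒≤ (dist< y W) ⟩
        suc m             ≡⟨ dist-cycle {x = x} {t = W} x≢W ⟨
        dist W x + pos x  ∎)))
      where
      open ≤-Reasoning
      x≢W : x ≢ W
      x≢W x≡W = ⟶⇒≢ {W} {x} W⟶x (sym x≡W)
    ... | tri< y<x _ _ with y Fin.≟ W
    ...   | yes y≡W = inj₂ (subst (_⟶ x) (sym y≡W) W⟶x)
    ...   | no y≢W  = inj₁ (⟶-shorten {x} {y} {P} (⟶P {x} (≤-<-trans 0<y y<x) x≤α) (dist-pos (y≢x ∘ sym))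
                        (+-cancelʳ-≤ 1 _ _ (begin
        dist x y + 1      ≤⟨ +-monoʳ-≤ (dist x y) 0<y ⟩
        dist x y + pos y  ≡⟨ dist-+ʳ {x = x} {y = y} {z = W} (<⇒≤ y<x) ⟩
        pos x             ≡⟨ dist-P {x} (<-trans 0<y y<x) ⟨
        dist x P + 1      ∎)))
      where
      open ≤-Reasoning
      0<y : 0 < pos y
      0<y = dist-pos y≢W

    bound : ∀ u → UUniversal Ψ u → dist a b ≤ suc m + u ∸ degree Ψ W
    bound u uu = begin
      dist a b            ≡⟨ m+n∸n≡m (dist a b) β ⟨
      dist a b + β ∸ β    ≡⟨ cong (_∸ β) (dist-+ʳ {x = a} {y = b} {z = W} β≤α) ⟩
      α ∸ β               ≤⟨ length-filter-range pos xs β (α ∸ β) hit ⟩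
      length (filter S? xs)
        ≡⟨ length-filter-split S? (Adj? Ψ W) xs ⟩
      #universal + #remote
        ≤⟨ m+n≤o⇒m≤o∸n (#universal + #remote) (begin
          #universal + #remote + degree Ψ W    ≡⟨ +-assoc #universal #remote (degree Ψ W) ⟩
          #universal + (#remote + degree Ψ W)  ≤⟨ +-mono-≤ universal≤u remote+degree≤n ⟩
          u + suc m                            ≡⟨ +-comm u (suc m) ⟩
          suc m + u                            ∎) ⟩
      suc m + u ∸ degree Ψ W ∎
      where
      open ≤-Reasoning
      xs = allFin (suc m)
      β+[α∸β]≡α : β + (α ∸ β) ≡ α
      β+[α∸β]≡α = m+[n∸m]≡n β≤α
      S : Fin (suc m) → Set
      S x = β < pos x × pos x ≤ β + (α ∸ β)
      S? : Decidable S
      S? x = (β <? pos x) ×-dec (pos x ≤? β + (α ∸ β))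
      #universal #remote : ℕ
      #universal = length (filter (S? ∩? Adj? Ψ W) xs)
      #remote = length (filter (S? ∩? ∁? (Adj? Ψ W)) xs)

      hit : ∀ k → β < k → k ≤ β + (α ∸ β) → ∃ λ x → x ∈ xs × pos x ≡ k
      hit k _ k≤
        with x , pos-x ← dist-surjectiveˡ W k (≤-<-trans (≤-trans k≤ (≤-reflexive β+[α∸β]≡α)) (dist< a W)) =
        x , ∈-allFin x , pos-x

      S∩Adj⇒Universal : ∀ {x} → S x × Adj Ψ W x → Universal Ψ x
      S∩Adj⇒Universal ((_ , x≤) , inj₁ W⟶x) = universal (≤-trans x≤ (≤-reflexive β+[α∸β]≡α)) W⟶x
      S∩Adj⇒Universal {x} ((β<x , _) , inj₂ x⟶W) = ⊥-elim (<⇒≱ β<x (IsFl-farthest {W} {b} {x} hb x⟶W))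

      universal≤u : #universal ≤ u
      universal≤u = uu _ (Unique.filter⁺ (S? ∩? Adj? Ψ W) (Unique.allFin⁺ (suc m)))
                         (All.map S∩Adj⇒Universal (all-filter (S? ∩? Adj? Ψ W) xs))

      remote+degree≤n : #remote + degree Ψ W ≤ suc m
      remote+degree≤n = ≤-trans (length-filter-disjoint (S? ∩? ∁? (Adj? Ψ W)) (Adj? Ψ W) proj₂ xs)
                                (≤-reflexive (length-tabulate id))

Fl-range-bound : ∀ {m} (Ψ : RoundRep m) u → UUniversal Ψ u → ∀ {W a b} →
                 IsFl Ψ (Nl Ψ W) a → IsFl Ψ W b → dist a b ≤ suc m + u ∸ degree Ψ W
Fl-range-bound Ψ u uu {W} {a} {b} ha hb with ⟶? Ψ (prev W) W
... | yes P⟶W = Fl-range.bound Ψ W a b P⟶W ha hb u uu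
... | no P↛W  = ≤-trans (≤-reflexive dist-a-b≡0) z≤n
  where
  dist-a-b≡0 : dist a b ≡ 0
  dist-a-b≡0 = trans (cong₂ dist (IsFl-self Ψ {W} {a} P↛W ha)
                                 (IsFl-self Ψ {W} {b} P↛W hb))
                     (dist-refl W)

lemma3 : Σ ℕ λ c → ∀ (m u : ℕ) (Ψ : RoundRep m) → Contig Ψ → UUniversal Ψ u →
           ∀ (W a b : Fin (suc m)) → IsFl Ψ (Nl Ψ W) a → IsFl Ψ W b →
           #CO a b ≤ c * (suc m + u ∸ degree Ψ W)
lemma3 = 1 , λ m u Ψ _ uu W a b ha hb →
  subst (dist a b ≤_) (sym (*-identityˡ _)) (Fl-range-bound Ψ u uu {W} {a} {b} ha hb)
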